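{- Let $n$ be a positive integer, $\Omega$ a finite set of cardinality $\nu$, $\sigma\in\mathrm{Sym}(\Omega)$, $G=\langle\sigma\rangle$, $\Omega=\coprod_{i=1}^r\Omega_i$ the decomposition of $\Omega$ into $G$-orbits, and $H=S_n\wr_\Omega G$. Then: (a) for each $\eta\in S_n^\Omega$, the element $\eta\sigma\in H$ maps each set $[n]\times\Omega_i$ to itself; (b) letting $T=\{\eta\sigma\in H:\eta\in S_n^\Omega,\ \eta\sigma\text{ acts transitively on }[n]\times\Omega_i\text{ for every }i\}$, the group $S_n^\Omega$ acts transitively on $T$ by conjugation, and $|T|=\frac{(n!)^\nu}{n^r}$.
   Context: $[n]=\{1,\ldots,n\}$. The permutational wreath product $S_n\wr_\Omega G$ is the subgroup of $\mathrm{Sym}([n]\times\Omega)$ generated by $(k,\omega)\mapsto(\zeta(\omega).k,\omega)$ for $\zeta\in S_n^\Omega=\{\text{maps }\Omega\to S_n\}$ and $(k,\omega)\mapsto(k,g.\omega)$ for $g\in G$; it equals $S_n^\Omega\rtimes G$, every element is uniquely $\zeta g$, acting by $(\zeta g).(k,\omega)=(\zeta(g.\omega).k,g.\omega)$. -}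

module Defs where

open import Level using (0ℓ)
open import Data.Nat using (ℕ; zero; suc)
open import Data.Fin using (Fin)
open import Data.Fin.Permutation using (Permutation′; _⟨$⟩ʳ_)
open import Data.Product using (Σ; ∃; _×_; _,_; proj₁)
open import Relation.Binary.PropositionalEquality using (_≡_; refl; sym; trans)
open import Relation.Binary.Bundles using (Setoid)

-- Ω = Fin ν, S_n = Permutation′ n acting on [n] = Fin n.
-- An element of S_n^Ω is a map Fin ν → Permutation′ n.
SnΩ : ℕ → ℕ → Set
SnΩ n ν = Fin ν → Permutation′ n

Pt : ℕ → ℕ → Set
Pt n ν = Fin n × Fin ν

actζσ : ∀ {n ν} → SnΩ n ν → Permutation′ ν → Pt n ν → Pt n ν
actζσ η σ (k , ω) = (η (σ ⟨$⟩ʳ ω) ⟨$⟩ʳ k , σ ⟨$⟩ʳ ω)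

actζ : ∀ {n ν} → SnΩ n ν → Pt n ν → Pt n ν
actζ ζ (k , ω) = (ζ ω ⟨$⟩ʳ k , ω)

iter : ∀ {A : Set} → (A → A) → ℕ → A → A
iter f zero    x = x
iter f (suc m) x = f (iter f m x)

SameOrbit : ∀ {ν} → Permutation′ ν → Fin ν → Fin ν → Set
SameOrbit σ ω ω' = ∃ λ j → iter (σ ⟨$⟩ʳ_) j ω ≡ ω'

-- A decomposition Ω = ⊔_{i ∈ Fin r} Ω_i into the ⟨σ⟩-orbits, given by the
-- labelling c : Ω → Fin r with Ω_i = c⁻¹(i): every label is used and two
-- points have the same label iff they lie in the same orbit.
IsOrbitDecomposition : ∀ {ν r} → Permutation′ ν → (Fin ν → Fin r) → Set
IsOrbitDecomposition {ν} {r} σ c =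
  ((i : Fin r) → ∃ λ ω → c ω ≡ i) ×
  ((ω ω' : Fin ν) → (c ω ≡ c ω' → SameOrbit σ ω ω') × (SameOrbit σ ω ω' → c ω ≡ c ω'))

TransitiveOnEach : ∀ {n ν r} → Permutation′ ν → (Fin ν → Fin r) → SnΩ n ν → Set
TransitiveOnEach {n} {ν} {r} σ c η =
  (i : Fin r) (k k' : Fin n) (ω ω' : Fin ν) → c ω ≡ i → c ω' ≡ i →
  ∃ λ m → iter (actζσ η σ) m (k , ω) ≡ (k' , ω')

-- The set T (elements ησ identified with η, since the decomposition ζ g is unique)
T : ∀ {n ν r} → Permutation′ ν → (Fin ν → Fin r) → Set
T {n} {ν} σ c = Σ (SnΩ n ν) (TransitiveOnEach {n} σ c)

-- Equality of elements of T: equality of the underlying elements ησ of H,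
-- i.e. equality as permutations of [n] × Ω.
T-setoid : ∀ {n ν r} → Permutation′ ν → (Fin ν → Fin r) → Setoid 0ℓ 0ℓ
T-setoid {n} {ν} {r} σ c = record
  { Carrier = T {n} σ c
  ; _≈_ = λ x y → ∀ p → actζσ (proj₁ x) σ p ≡ actζσ (proj₁ y) σ p
  ; isEquivalence = record
    { refl = λ p → refl ; sym = λ e p → sym (e p) ; trans = λ e f p → trans (e p) (f p) } }

-- Conjugation: ζ (η σ) ζ⁻¹ = η' σ, written without inverses as
-- ζ ∘ (ησ) = (η'σ) ∘ ζ as maps on [n] × Ω.
ConjBy : ∀ {n ν} → SnΩ n ν → Permutation′ ν → SnΩ n ν → SnΩ n ν → Set
ConjBy {n} {ν} ζ σ η η' = ∀ (p : Pt n ν) → actζ ζ (actζσ η σ p) ≡ actζσ η' σ (actζ ζ p)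

{-# OPTIONS --safe #-}
-- For η ∈ S_n^Ω write (ησ)^m (k , ω) = (w_m k , σ^m ω). On the orbit of a base
-- point b, of length ℓ, everything is governed by the holonomy h_b = w_ℓ, the
-- return map of (ησ)^ℓ on [n] × {b}: ησ is transitive on [n] × Ω_i exactly when
-- h_b is an n-cycle. Replacing η(b) by h_b at every base point is a bijection of
-- S_n^Ω, because the walk from b back to its last point before returning never
-- uses η(b). So T corresponds to families that are n-cycles at the r base points
-- and arbitrary elsewhere; an n-cycle is the conjugate of a fixed rotation by a
-- unique permutation fixing 0, so there are (n-1)! of them and
-- |T| = ((n-1)!)^r (n!)^(ν-r) = (n!)^ν / n^r.
-- Conjugation by ζ ∈ S_n^Ω preserves transitivity. Conversely, the holonomies of
-- two elements of T at b are conjugate n-cycles, and a conjugator at b is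
-- propagated along the orbit by the two walks.
module Submission where

open import Defs
open import Level using (0ℓ)
open import Data.Nat using (ℕ; zero; suc; _+_; _*_; _∸_; _≤_; _<_; z≤n; s≤s; NonZero; pred; _%_; _/_; _!; _^_)
open import Data.Nat.Properties
open import Data.Nat.DivMod using (m≡m%n+[m/n]*n; m%n<n; m<n⇒m%n≡m; %-distribˡ-+; m%n%n≡m%n; [m+n]%n≡m%n; /-congˡ; m*n/n≡m)
open import Data.Fin using (Fin; zero; suc; toℕ; fromℕ<; punchIn; punchOut) renaming (_≟_ to _≟ᶠ_)
open import Data.Fin.Properties using (toℕ<n; toℕ-injective; toℕ-fromℕ<; fromℕ<-injective; punchOut-cong; pigeonhole; injective⇒≤; *↔×)
  renaming (suc-injective to Fin-suc-injective)
open import Data.Fin.Permutation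
  using (Permutation′; permutation; _⟨$⟩ʳ_; _⟨$⟩ˡ_; inverseˡ; inverseʳ; flip; _∘ₚ_; insert; remove; lift₀;
         insert-remove; remove-insert; lift₀-cong; lift₀-remove; ↔⇒≡)
  renaming (_≈_ to _≈ₚ_; id to idₚ)
open import Data.Product using (Σ; ∃; _×_; _,_; proj₁; proj₂)
open import Data.Product.Relation.Binary.Pointwise.NonDependent using (_×ₛ_; Pointwise-≡↔≡)
open import Data.Product.Function.NonDependent.Setoid using (_×-inverse_)
open import Data.Sum using (inj₁; inj₂)
open import Data.Empty using (⊥-elim)
open import Relation.Nullary using (¬_; Dec; yes; no; does)
open import Relation.Nullary.Decidable using (dec-true; dec-false)
open import Data.Bool using (if_then_else_)
open import Relation.Binary.Bundles using (Setoid)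
open import Relation.Binary.Definitions using (tri<; tri≈; tri>)
open import Relation.Binary.PropositionalEquality
open import Function.Base using (_∘_)
open import Function.Bundles using (Inverse; Bijection)
open import Function.Properties.Inverse using (Inverse⇒Bijection)
open import Function.Consequences.Setoid using (strictlyInverseˡ⇒inverseˡ; strictlyInverseʳ⇒inverseʳ)
open import Data.Nat.Solver using (module +-*-Solver)
import Relation.Binary.Construct.On as On
import Function.Construct.Composition as Composition
import Function.Construct.Identity as Identity
import Function.Construct.Symmetry as Symmetry

module _ {A : Set} (f : A → A) where

  iter-+ : ∀ a b x → iter f (a + b) x ≡ iter f a (iter f b x)
  iter-+ zero    b x = refl
  iter-+ (suc a) b x = cong f (iter-+ a b x)

  iter-comm : ∀ a b x → iter f a (iter f b x) ≡ iter f b (iter f a x)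
  iter-comm a b x = begin
    iter f a (iter f b x) ≡⟨ iter-+ a b x ⟨
    iter f (a + b) x      ≡⟨ cong (λ k → iter f k x) (+-comm a b) ⟩
    iter f (b + a) x      ≡⟨ iter-+ b a x ⟩
    iter f b (iter f a x) ∎
    where open ≡-Reasoning

  iter-*-fixed : ∀ {d x} → iter f d x ≡ x → ∀ k → iter f (k * d) x ≡ x
  iter-*-fixed         fix zero    = refl
  iter-*-fixed {d} {x} fix (suc k) =
    trans (iter-+ d (k * d) x) (trans (cong (iter f d) (iter-*-fixed fix k)) fix)

  module _ (f-inj : ∀ {a b} → f a ≡ f b → a ≡ b) where

    iter-injective : ∀ m {y z} → iter f m y ≡ iter f m z → y ≡ z
    iter-injective zero    e = e
    iter-injective (suc m) e = iter-injective m (f-inj e)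

    iter-return : ∀ a k x → iter f (k + a) x ≡ iter f a x → iter f k x ≡ x
    iter-return a k x e = iter-injective a (trans (iter-comm a k x) (trans (sym (iter-+ k a x)) e))

iter-cong : ∀ {A : Set} {f g : A → A} → (∀ x → f x ≡ g x) → ∀ a x → iter f a x ≡ iter g a x
iter-cong f≗g zero    x = refl
iter-cong {g = g} f≗g (suc a) x = trans (f≗g _) (cong g (iter-cong f≗g a x))

iter-semiconj : ∀ {A B : Set} {f : A → A} {g : B → B} (h : A → B) →
                (∀ x → h (f x) ≡ g (h x)) → ∀ m x → h (iter f m x) ≡ iter g m (h x)
iter-semiconj h hf≗gh zero    x = refl
iter-semiconj {g = g} h hf≗gh (suc m) x = trans (hf≗gh _) (cong g (iter-semiconj h hf≗gh m x))

minimal-witness : (P : ℕ → Set) → (∀ k → Dec (P k)) → ∀ d → P d →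
                  ∃ λ p → P p × p ≤ d × (∀ q → q < p → ¬ P q)
minimal-witness P P? d pd with P? 0
... | yes p0 = 0 , p0 , z≤n , λ q ()
minimal-witness P P? zero    pd | no ¬p0 = ⊥-elim (¬p0 pd)
minimal-witness P P? (suc d) pd | no ¬p0
  with p , pp , p≤d , below ← minimal-witness (P ∘ suc) (P? ∘ suc) d pd =
  suc p , pp , s≤s p≤d , λ { zero _ → ¬p0 ; (suc q) (s≤s q<p) → below q q<p }

module Return {A : Set} (f : A → A) (f-inj : ∀ {a b} → f a ≡ f b → a ≡ b) (x : A)
              (d : ℕ) .{{_ : NonZero d}} (return : iter f d x ≡ x) where

  iter-% : ∀ a → iter f a x ≡ iter f (a % d) x
  iter-% a = begin
    iter f a x                              ≡⟨ cong (λ k → iter f k x) (m≡m%n+[m/n]*n a d) ⟩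
    iter f (a % d + a / d * d) x            ≡⟨ iter-+ f (a % d) (a / d * d) x ⟩
    iter f (a % d) (iter f (a / d * d) x)   ≡⟨ cong (iter f (a % d)) (iter-*-fixed f return (a / d)) ⟩
    iter f (a % d) x                        ∎
    where open ≡-Reasoning

  module Minimal (minimal : ∀ q → 0 < q → q < d → ¬ iter f q x ≡ x) where

    private
      no-repeat : ∀ a b → a < b → b < d → ¬ iter f a x ≡ iter f b x
      no-repeat a b a<b b<d e with o , refl ← m≤n⇒∃[o]m+o≡n a<b =
        minimal (suc o) (s≤s z≤n) (≤-<-trans (s≤s (m≤n+m o a)) b<d)
          (iter-return f f-inj a (suc o) x
            (trans (cong (λ k → iter f (suc k) x) (+-comm o a)) (sym e)))

    iter-injective-< : ∀ a b → a < d → b < d → iter f a x ≡ iter f b x → a ≡ b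
    iter-injective-< a b a<d b<d e with <-cmp a b
    ... | tri< a<b _ _ = ⊥-elim (no-repeat a b a<b b<d e)
    ... | tri≈ _ a≡b _ = a≡b
    ... | tri> _ _ b<a = ⊥-elim (no-repeat b a b<a a<d (sym e))

    iter-≡⇒%-≡ : ∀ a b → iter f a x ≡ iter f b x → a % d ≡ b % d
    iter-≡⇒%-≡ a b e = iter-injective-< (a % d) (b % d) (m%n<n a d) (m%n<n b d)
      (trans (sym (iter-% a)) (trans e (iter-% b)))

module Period {m : ℕ} (f : Fin m → Fin m) (f-inj : ∀ {a b} → f a ≡ f b → a ≡ b) (x : Fin m) where

  private
    some-return : ∃ λ k → suc k ≤ m × iter f (suc k) x ≡ x
    some-return =
      let i , j , i<j , e = pigeonhole (n<1+n m) (λ i → iter f (toℕ i) x)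
          o , i+o≡j       = m≤n⇒∃[o]m+o≡n i<j
      in o , ≤-trans (s≤s (m≤n+m o (toℕ i))) (≤-trans (≤-reflexive i+o≡j) (≤-pred (toℕ<n j))) ,
      iter-return f f-inj (toℕ i) (suc o) x
        (trans (cong (λ k → iter f k x) (trans (cong suc (+-comm o (toℕ i))) i+o≡j)) (sym e))

  -- Opaque, so that the type checker never evaluates the pigeonhole search.
  opaque
    least : ∃ λ p → iter f (suc p) x ≡ x × p ≤ proj₁ some-return × (∀ q → q < p → ¬ iter f (suc q) x ≡ x)
    least = minimal-witness (λ k → iter f (suc k) x ≡ x) (λ k → iter f (suc k) x ≟ᶠ x)
                            (proj₁ some-return) (proj₂ (proj₂ some-return))

  period : ℕ
  period = suc (proj₁ least)

  period-return : iter f period x ≡ x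
  period-return = proj₁ (proj₂ least)

  period≤ : period ≤ m
  period≤ = ≤-trans (s≤s (proj₁ (proj₂ (proj₂ least)))) (proj₁ (proj₂ some-return))

  period-minimal : ∀ q → 0 < q → q < period → ¬ iter f q x ≡ x
  period-minimal (suc q) _ (s≤s q<p) = proj₂ (proj₂ (proj₂ least)) q q<p

  open Return f f-inj x period period-return public
  open Minimal period-minimal public

infixr 9 _⨾_

_⨾_ : ∀ {R S T : Setoid 0ℓ 0ℓ} → Inverse R S → Inverse S T → Inverse R T
_⨾_ = Composition.inverse

mkInverse : ∀ {S T : Setoid 0ℓ 0ℓ}
  (to : Setoid.Carrier S → Setoid.Carrier T) (from : Setoid.Carrier T → Setoid.Carrier S) →
  (∀ {x y} → Setoid._≈_ S x y → Setoid._≈_ T (to x) (to y)) →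
  (∀ {x y} → Setoid._≈_ T x y → Setoid._≈_ S (from x) (from y)) →
  (∀ y → Setoid._≈_ T (to (from y)) y) → (∀ x → Setoid._≈_ S (from (to x)) x) → Inverse S T
mkInverse {S} {T} to from to-cong from-cong to∘from from∘to = record
  { to = to ; from = from ; to-cong = to-cong ; from-cong = from-cong
  ; inverse = strictlyInverseˡ⇒inverseˡ S T to-cong to∘from
            , strictlyInverseʳ⇒inverseʳ S T from-cong from∘to }

Fin×Fin↔Fin* : ∀ a b → Inverse (setoid (Fin a) ×ₛ setoid (Fin b)) (setoid (Fin (a * b)))
Fin×Fin↔Fin* a b = Pointwise-≡↔≡ ⨾ Symmetry.inverse *↔×

Perm : ℕ → Setoid 0ℓ 0ℓ
Perm n = On.setoid (Fin n →-setoid Fin n) _⟨$⟩ʳ_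

⟨$⟩ʳ-injective : ∀ {n} (π : Permutation′ n) {a b} → π ⟨$⟩ʳ a ≡ π ⟨$⟩ʳ b → a ≡ b
⟨$⟩ʳ-injective π {a} {b} e = trans (sym (inverseˡ π)) (trans (cong (π ⟨$⟩ˡ_) e) (inverseˡ π))

flip-cong : ∀ {n} (π ρ : Permutation′ n) → π ≈ₚ ρ → flip π ≈ₚ flip ρ
flip-cong π ρ e x = ⟨$⟩ʳ-injective ρ (trans (sym (e _)) (trans (inverseʳ π) (sym (inverseʳ ρ))))

∘ₚ-cong : ∀ {n} (π π′ ρ ρ′ : Permutation′ n) → π ≈ₚ π′ → ρ ≈ₚ ρ′ → π ∘ₚ ρ ≈ₚ π′ ∘ₚ ρ′
∘ₚ-cong _ _ ρ _ e e′ x = trans (cong (ρ ⟨$⟩ʳ_) (e x)) (e′ _)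

remove-cong : ∀ {n} (π ρ : Permutation′ (suc n)) → π ≈ₚ ρ → remove zero π ≈ₚ remove zero ρ
remove-cong _ _ e j = punchOut-cong′ (e zero) (e (suc j))
  where
  punchOut-cong′ : ∀ {n} {i i′ j j′ : Fin (suc n)} {p : ¬ i ≡ j} {p′ : ¬ i′ ≡ j′} →
                   i ≡ i′ → j ≡ j′ → punchOut p ≡ punchOut p′
  punchOut-cong′ {i = i} refl refl = punchOut-cong i refl

insert-cong : ∀ {n} {j j′ : Fin (suc n)} {π ρ : Permutation′ n} → j ≡ j′ → π ≈ₚ ρ →
              insert zero j π ≈ₚ insert zero j′ ρ
insert-cong refl e zero    = refl
insert-cong {j = j} refl e (suc k) = cong (punchIn j) (e k)

Perm-suc↔Fin×Perm : ∀ n → Inverse (Perm (suc n)) (setoid (Fin (suc n)) ×ₛ Perm n)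
Perm-suc↔Fin×Perm n = mkInverse
  (λ π → π ⟨$⟩ʳ zero , remove zero π) (λ (j , π) → insert zero j π)
  (λ {π} {ρ} e → e zero , remove-cong π ρ e) (λ (e , e′) → insert-cong e e′)
  (λ (j , π) → refl , remove-insert zero j π) (insert-remove zero)

Perm↔Fin! : ∀ n → Inverse (Perm n) (setoid (Fin (n !)))
Perm↔Fin! zero    = mkInverse (λ _ → zero) (λ _ → idₚ) (λ _ → refl) (λ _ ()) (λ { zero → refl }) (λ _ ())
Perm↔Fin! (suc n) =
  Perm-suc↔Fin×Perm n ⨾ (Identity.inverse (setoid (Fin (suc n))) ×-inverse Perm↔Fin! n) ⨾ Fin×Fin↔Fin* (suc n) (n !)

IsCycle : ∀ {n} → Permutation′ n → Set
IsCycle π = ∀ k k′ → ∃ λ t → iter (π ⟨$⟩ʳ_) t k ≡ k′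

IsCycle-resp : ∀ {n} (π ρ : Permutation′ n) → π ≈ₚ ρ → IsCycle π → IsCycle ρ
IsCycle-resp _ _ π≈ρ π-cycle k k′ =
  let t , e = π-cycle k k′ in t , trans (sym (iter-cong π≈ρ t k)) e

PermWith : ∀ n → (Permutation′ n → Set) → Setoid 0ℓ 0ℓ
PermWith n P = On.setoid (Perm n) (proj₁ {B = P})

Cycle : ℕ → Setoid 0ℓ 0ℓ
Cycle n = PermWith n IsCycle

[1+m%n]%n≡[1+m]%n : ∀ m n .{{_ : NonZero n}} → suc (m % n) % n ≡ suc m % n
[1+m%n]%n≡[1+m]%n m n = begin
  (1 + m % n) % n             ≡⟨ %-distribˡ-+ 1 (m % n) n ⟩
  (1 % n + m % n % n) % n     ≡⟨ cong (λ k → (1 % n + k) % n) (m%n%n≡m%n m n) ⟩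
  (1 % n + m % n) % n         ≡⟨ %-distribˡ-+ 1 m n ⟨
  (1 + m) % n                 ∎
  where open ≡-Reasoning

module Rotation (n′ : ℕ) where

  n : ℕ
  n = suc n′

  next : Fin n → Fin n
  next j = fromℕ< (m%n<n (suc (toℕ j)) n)

  toℕ-iter-next : ∀ t j → toℕ (iter next t j) ≡ (toℕ j + t) % n
  toℕ-iter-next zero    j = trans (sym (m<n⇒m%n≡m (toℕ<n j))) (cong (_% n) (sym (+-identityʳ (toℕ j))))
  toℕ-iter-next (suc t) j = begin
    toℕ (next (iter next t j))    ≡⟨ toℕ-fromℕ< _ ⟩
    suc (toℕ (iter next t j)) % n ≡⟨ cong (λ k → suc k % n) (toℕ-iter-next t j) ⟩
    suc ((toℕ j + t) % n) % n     ≡⟨ [1+m%n]%n≡[1+m]%n (toℕ j + t) n ⟩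
    suc (toℕ j + t) % n           ≡⟨ cong (_% n) (+-suc (toℕ j) t) ⟨
    (toℕ j + suc t) % n           ∎
    where open ≡-Reasoning

  iter-next-n : ∀ j → iter next n j ≡ j
  iter-next-n j = toℕ-injective (trans (toℕ-iter-next n j) (trans ([m+n]%n≡m%n (toℕ j) n) (m<n⇒m%n≡m (toℕ<n j))))

  iter-next-zero : ∀ j → iter next (toℕ j) zero ≡ j
  iter-next-zero j = toℕ-injective (trans (toℕ-iter-next (toℕ j) zero) (m<n⇒m%n≡m (toℕ<n j)))

  rotate : Permutation′ n
  rotate = permutation next (iter next n′) iter-next-n
    (λ j → trans (sym (iter-+ next n′ 1 j)) (trans (cong (λ k → iter next k j) (+-comm n′ 1)) (iter-next-n j)))

  -- g ρ g⁻¹ for the rotation ρ (composition ∘ₚ is diagrammatic).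
  conjugate-rotate : Permutation′ n → Permutation′ n
  conjugate-rotate g = flip g ∘ₚ rotate ∘ₚ g

  conjugate-rotate-cong : ∀ g h → g ≈ₚ h → conjugate-rotate g ≈ₚ conjugate-rotate h
  conjugate-rotate-cong g h g≈h x =
    trans (g≈h _) (cong (λ y → h ⟨$⟩ʳ (rotate ⟨$⟩ʳ y)) (flip-cong g h g≈h x))

  iter-conjugate-rotate : ∀ g t x → iter (conjugate-rotate g ⟨$⟩ʳ_) t x ≡ g ⟨$⟩ʳ iter next t (g ⟨$⟩ˡ x)
  iter-conjugate-rotate g zero    x = sym (inverseʳ g)
  iter-conjugate-rotate g (suc t) x =
    trans (cong (λ y → g ⟨$⟩ʳ next (g ⟨$⟩ˡ y)) (iter-conjugate-rotate g t x))
          (cong (λ y → g ⟨$⟩ʳ next y) (inverseˡ g))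

  conjugate-rotate-isCycle : ∀ g → IsCycle (conjugate-rotate g)
  conjugate-rotate-isCycle g k k′ = n ∸ a + b ,
    trans (iter-conjugate-rotate g (n ∸ a + b) k)
          (trans (cong (g ⟨$⟩ʳ_) (toℕ-injective toℕ-reached)) (inverseʳ g))
    where
    a = toℕ (g ⟨$⟩ˡ k)
    b = toℕ (g ⟨$⟩ˡ k′)
    toℕ-reached : toℕ (iter next (n ∸ a + b) (g ⟨$⟩ˡ k)) ≡ b
    toℕ-reached = begin
      toℕ (iter next (n ∸ a + b) (g ⟨$⟩ˡ k)) ≡⟨ toℕ-iter-next (n ∸ a + b) (g ⟨$⟩ˡ k) ⟩
      (a + (n ∸ a + b)) % n                  ≡⟨ cong (_% n) (+-assoc a (n ∸ a) b) ⟨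
      (a + (n ∸ a) + b) % n                  ≡⟨ cong (λ m → (m + b) % n) (m+[n∸m]≡n (<⇒≤ (toℕ<n (g ⟨$⟩ˡ k)))) ⟩
      (n + b) % n                            ≡⟨ cong (_% n) (+-comm n b) ⟩
      (b + n) % n                            ≡⟨ [m+n]%n≡m%n b n ⟩
      b % n                                  ≡⟨ m<n⇒m%n≡m (toℕ<n (g ⟨$⟩ˡ k′)) ⟩
      b                                      ∎
      where open ≡-Reasoning

-- A cycle C is conjugate to the rotation by `unroll`, which sends j to C^j(0).
module Unrolling {n′ : ℕ} (C : Permutation′ (suc n′)) (C-cycle : IsCycle C) where

  open Rotation n′

  private
    c : Fin n → Fin n
    c = C ⟨$⟩ʳ_

    c-inj : ∀ {a b} → c a ≡ c b → a ≡ b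
    c-inj = ⟨$⟩ʳ-injective C

    time : Fin n → ℕ
    time y = proj₁ (C-cycle zero y)

    iter-time : ∀ y → iter c (time y) zero ≡ y
    iter-time y = proj₂ (C-cycle zero y)

    module P = Period c c-inj zero

    n≤period : n ≤ P.period
    n≤period = injective⇒≤ {f = λ y → fromℕ< (m%n<n (time y) P.period)} λ {y} {y′} e → begin
      y                                   ≡⟨ iter-time y ⟨
      iter c (time y) zero                ≡⟨ P.iter-% (time y) ⟩
      iter c (time y % P.period) zero     ≡⟨ cong (λ k → iter c k zero) (fromℕ<-injective _ _ _ _ e) ⟩
      iter c (time y′ % P.period) zero    ≡⟨ P.iter-% (time y′) ⟨
      iter c (time y′) zero               ≡⟨ iter-time y′ ⟩
      y′                                  ∎
      where open ≡-Reasoning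

    period≡n : P.period ≡ n
    period≡n = ≤-antisym P.period≤ n≤period

  open Return c c-inj zero n (subst (λ k → iter c k zero ≡ zero) period≡n P.period-return)
  open Minimal (λ q 0<q q<n → P.period-minimal q 0<q (subst (q <_) (sym period≡n) q<n))

  unroll : Permutation′ n
  unroll = permutation (λ j → iter c (toℕ j) zero) (λ y → fromℕ< (m%n<n (time y) n))
    (λ y → trans (cong (λ k → iter c k zero) (toℕ-fromℕ< (m%n<n (time y) n))) (trans (sym (iter-% (time y))) (iter-time y)))
    (λ j → toℕ-injective (trans (toℕ-fromℕ< (m%n<n (time (iter c (toℕ j) zero)) n))
             (trans (iter-≡⇒%-≡ (time _) (toℕ j) (iter-time _)) (m<n⇒m%n≡m (toℕ<n j)))))

  unroll-rotate : ∀ j → unroll ⟨$⟩ʳ (rotate ⟨$⟩ʳ j) ≡ C ⟨$⟩ʳ (unroll ⟨$⟩ʳ j)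
  unroll-rotate j = trans (cong (λ k → iter c k zero) (toℕ-fromℕ< (m%n<n (suc (toℕ j)) n))) (sym (iter-% (suc (toℕ j))))

  unroll⁻¹-C : ∀ x → unroll ⟨$⟩ˡ (C ⟨$⟩ʳ x) ≡ rotate ⟨$⟩ʳ (unroll ⟨$⟩ˡ x)
  unroll⁻¹-C x = ⟨$⟩ʳ-injective unroll
    (trans (inverseʳ unroll) (trans (cong c (sym (inverseʳ unroll))) (sym (unroll-rotate _))))

  conjugate-unroll : conjugate-rotate unroll ≈ₚ C
  conjugate-unroll x = trans (unroll-rotate (unroll ⟨$⟩ˡ x)) (cong c (inverseʳ unroll))

unroll-cong : ∀ {n′} {C D : Permutation′ (suc n′)} C-cycle D-cycle → C ≈ₚ D →
              Unrolling.unroll C C-cycle ≈ₚ Unrolling.unroll D D-cycle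
unroll-cong _ _ C≈D j = iter-cong C≈D (toℕ j) zero

unroll-conjugate-rotate : ∀ {n′} (g : Permutation′ (suc n′)) → g ⟨$⟩ˡ zero ≡ zero →
  Unrolling.unroll (Rotation.conjugate-rotate n′ g) (Rotation.conjugate-rotate-isCycle n′ g) ≈ₚ g
unroll-conjugate-rotate {n′} g g-fixes-0 j = begin
  iter (conjugate-rotate g ⟨$⟩ʳ_) (toℕ j) zero ≡⟨ iter-conjugate-rotate g (toℕ j) zero ⟩
  g ⟨$⟩ʳ iter next (toℕ j) (g ⟨$⟩ˡ zero)       ≡⟨ cong (λ x → g ⟨$⟩ʳ iter next (toℕ j) x) g-fixes-0 ⟩
  g ⟨$⟩ʳ iter next (toℕ j) zero                ≡⟨ cong (g ⟨$⟩ʳ_) (iter-next-zero j) ⟩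
  g ⟨$⟩ʳ j                                     ∎
  where
  open ≡-Reasoning
  open Rotation n′

-- A cycle on n+1 points is determined by its unrolling, which fixes 0.
Cycle↔Perm : ∀ n′ → Inverse (Cycle (suc n′)) (Perm n′)
Cycle↔Perm n′ = mkInverse
  (λ (C , C-cycle) → remove zero (unroll C C-cycle))
  (λ ρ → conjugate-rotate (lift₀ ρ) , conjugate-rotate-isCycle (lift₀ ρ))
  (λ {(C , C-cycle)} {(D , D-cycle)} C≈D →
    remove-cong (unroll C C-cycle) (unroll D D-cycle) (unroll-cong {C = C} {D} C-cycle D-cycle C≈D))
  (λ {ρ} {ρ′} ρ≈ρ′ → conjugate-rotate-cong (lift₀ ρ) (lift₀ ρ′) (lift₀-cong ρ ρ′ ρ≈ρ′))
  (λ ρ → remove-cong (unroll (conjugate-rotate (lift₀ ρ)) (conjugate-rotate-isCycle (lift₀ ρ))) (lift₀ ρ)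
                     (unroll-conjugate-rotate (lift₀ ρ) refl))
  (λ (C , C-cycle) i →
    let U = unroll C C-cycle in
    trans (conjugate-rotate-cong (lift₀ (remove zero U)) U (lift₀-remove U refl) i) (conjugate-unroll C C-cycle i))
  where
  open Rotation n′
  open Unrolling using (unroll; conjugate-unroll)

Cycle↔Fin! : ∀ n′ → Inverse (Cycle (suc n′)) (setoid (Fin (n′ !)))
Cycle↔Fin! n′ = Cycle↔Perm n′ ⨾ Perm↔Fin! n′

∏ : ∀ ν → (Fin ν → ℕ) → ℕ
∏ zero    k = 1
∏ (suc ν) k = k zero * ∏ ν (k ∘ suc)

Π-setoid : ∀ ν → (Fin ν → Setoid 0ℓ 0ℓ) → Setoid 0ℓ 0ℓ
Π-setoid ν S = record
  { Carrier = (ω : Fin ν) → Setoid.Carrier (S ω)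
  ; _≈_ = λ f g → ∀ ω → Setoid._≈_ (S ω) (f ω) (g ω)
  ; isEquivalence = record
    { refl = λ ω → Setoid.refl (S ω) ; sym = λ e ω → Setoid.sym (S ω) (e ω)
    ; trans = λ e e′ ω → Setoid.trans (S ω) (e ω) (e′ ω) } }

Π-suc↔× : ∀ ν (S : Fin (suc ν) → Setoid 0ℓ 0ℓ) → Inverse (Π-setoid (suc ν) S) (S zero ×ₛ Π-setoid ν (S ∘ suc))
Π-suc↔× ν S = mkInverse
  (λ f → f zero , f ∘ suc) (λ { (x , f) zero → x ; (x , f) (suc ω) → f ω })
  (λ e → e zero , e ∘ suc) (λ { (e , e′) zero → e ; (e , e′) (suc ω) → e′ ω })
  (λ _ → Setoid.refl (S zero ×ₛ Π-setoid ν (S ∘ suc)))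
  (λ { f zero → Setoid.refl (S zero) ; f (suc ω) → Setoid.refl (S (suc ω)) })

Π↔Fin∏ : ∀ ν (S : Fin ν → Setoid 0ℓ 0ℓ) (k : Fin ν → ℕ) →
         (∀ ω → Inverse (S ω) (setoid (Fin (k ω)))) → Inverse (Π-setoid ν S) (setoid (Fin (∏ ν k)))
Π↔Fin∏ zero    S k count = mkInverse (λ _ → zero) (λ _ ()) (λ _ → refl) (λ _ ()) (λ { zero → refl }) (λ _ ())
Π↔Fin∏ (suc ν) S k count =
  Π-suc↔× ν S ⨾ (count zero ×-inverse Π↔Fin∏ ν (S ∘ suc) (k ∘ suc) (count ∘ suc)) ⨾ Fin×Fin↔Fin* (k zero) (∏ ν (k ∘ suc))

CycleIf : ℕ → Set → Setoid 0ℓ 0ℓ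
CycleIf n A = PermWith n (λ π → A → IsCycle π)

CycleIf↔Fin : ∀ n′ {A} (A? : Dec A) → Inverse (CycleIf (suc n′) A) (setoid (Fin (if does A? then n′ ! else suc n′ !)))
CycleIf↔Fin n′ (yes a) = mkInverse (λ (π , π-cycle) → π , π-cycle a) (λ (π , π-cycle) → π , λ _ → π-cycle)
  (λ e → e) (λ e → e) (λ _ _ → refl) (λ _ _ → refl) ⨾ Cycle↔Fin! n′
CycleIf↔Fin n′ (no ¬a) = mkInverse proj₁ (λ π → π , λ a → ⊥-elim (¬a a))
  (λ e → e) (λ e → e) (λ _ _ → refl) (λ _ _ → refl) ⨾ Perm↔Fin! (suc n′)

count : ∀ {ν} {B : Fin ν → Set} → (∀ ω → Dec (B ω)) → ℕ
count {zero}  B? = 0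
count {suc ν} B? = if does (B? zero) then suc (count (B? ∘ suc)) else count (B? ∘ suc)

Subset : ∀ {ν} → (Fin ν → Set) → Setoid 0ℓ 0ℓ
Subset {ν} B = On.setoid (setoid (Fin ν)) (proj₁ {B = B})

Subset↔Fin-count : ∀ {ν} {B : Fin ν → Set} (B? : ∀ ω → Dec (B ω)) → Inverse (Subset B) (setoid (Fin (count B?)))
Subset↔Fin-count {zero} B? = mkInverse (λ ()) (λ ()) (λ { {()} }) (λ { {()} }) (λ ()) (λ ())
Subset↔Fin-count {suc ν} {B} B? with B? zero | Subset↔Fin-count (B? ∘ suc)
... | yes b₀ | I = mkInverse to from
  (λ { {zero , _} {zero , _} _ → refl ; {suc _ , _} {suc _ , _} e → cong suc (I.to-cong (Fin-suc-injective e)) })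
  (λ { refl → refl })
  (λ { zero → refl ; (suc j) → cong suc (I.strictlyInverseˡ j) })
  (λ { (zero , _) → refl ; (suc ω , b) → cong suc (I.strictlyInverseʳ (ω , b)) })
  where
  module I = Inverse I
  to : Σ (Fin (suc ν)) B → Fin (suc (count (B? ∘ suc)))
  to (zero  , _) = zero
  to (suc ω , b) = suc (I.to (ω , b))
  from : Fin (suc (count (B? ∘ suc))) → Σ (Fin (suc ν)) B
  from zero    = zero , b₀
  from (suc j) = let ω , b = I.from j in suc ω , b
... | no ¬b₀ | I = mkInverse to (λ j → let ω , b = I.from j in suc ω , b)
  (λ { {zero , b} _ → ⊥-elim (¬b₀ b) ; {suc _ , _} {zero , b} _ → ⊥-elim (¬b₀ b)
     ; {suc _ , _} {suc _ , _} e → I.to-cong (Fin-suc-injective e) })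
  (λ { refl → refl })
  I.strictlyInverseˡ
  (λ { (zero , b) → ⊥-elim (¬b₀ b) ; (suc ω , b) → cong suc (I.strictlyInverseʳ (ω , b)) })
  where
  module I = Inverse I
  to : Σ (Fin (suc ν)) B → Fin (count (B? ∘ suc))
  to (zero  , b) = ⊥-elim (¬b₀ b)
  to (suc ω , b) = I.to (ω , b)

∏-CycleIf-size : ∀ n′ ν {B : Fin ν → Set} (B? : ∀ ω → Dec (B ω)) →
                 ∏ ν (λ ω → if does (B? ω) then n′ ! else suc n′ !) * suc n′ ^ count B? ≡ (suc n′ !) ^ ν
∏-CycleIf-size n′ zero    B? = refl
∏-CycleIf-size n′ (suc ν) B? with B? zero | ∏-CycleIf-size n′ ν (B? ∘ suc)
... | yes _ | ih = trans (rearrange (n′ !) _ (suc n′) _) (cong (suc n′ ! *_) ih)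
  where
  open +-*-Solver
  rearrange : ∀ a p m x → a * p * (m * x) ≡ m * a * (p * x)
  rearrange = solve 4 (λ a p m x → a :* p :* (m :* x) := m :* a :* (p :* x)) refl
... | no _  | ih = trans (*-assoc (suc n′ !) _ _) (cong (suc n′ ! *_) ih)

module _ {n ν : ℕ} (σ : Permutation′ ν) where

  conjugate : SnΩ n ν → SnΩ n ν → SnΩ n ν
  conjugate ζ η ω = flip (ζ (σ ⟨$⟩ˡ ω)) ∘ₚ η ω ∘ₚ ζ ω

  ConjBy-conjugate : ∀ ζ η → ConjBy ζ σ η (conjugate ζ η)
  ConjBy-conjugate ζ η (k , ω) =
    cong (λ x → ζ (σ ⟨$⟩ʳ ω) ⟨$⟩ʳ (η (σ ⟨$⟩ʳ ω) ⟨$⟩ʳ x) , σ ⟨$⟩ʳ ω) (sym ζ⁻¹ζ)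
    where
    ζ⁻¹ζ : ζ (σ ⟨$⟩ˡ (σ ⟨$⟩ʳ ω)) ⟨$⟩ˡ (ζ ω ⟨$⟩ʳ k) ≡ k
    ζ⁻¹ζ = subst (λ ω′ → ζ ω′ ⟨$⟩ˡ (ζ ω ⟨$⟩ʳ k) ≡ k) (sym (inverseˡ σ)) (inverseˡ (ζ ω))

  actζσ-≡⇒≈ : ∀ (η η′ : SnΩ n ν) → (∀ p → actζσ η σ p ≡ actζσ η′ σ p) → ∀ ω → η ω ≈ₚ η′ ω
  actζσ-≡⇒≈ η η′ e ω k =
    subst (λ ω′ → η ω′ ⟨$⟩ʳ k ≡ η′ ω′ ⟨$⟩ʳ k) (inverseʳ σ) (cong proj₁ (e (k , σ ⟨$⟩ˡ ω)))

  ≈⇒actζσ-≡ : ∀ (η η′ : SnΩ n ν) → (∀ ω → η ω ≈ₚ η′ ω) → ∀ p → actζσ η σ p ≡ actζσ η′ σ p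
  ≈⇒actζσ-≡ η η′ e (k , ω) = cong (_, σ ⟨$⟩ʳ ω) (e (σ ⟨$⟩ʳ ω) k)

module _ {n ν r : ℕ} {σ : Permutation′ ν} {c : Fin ν → Fin r} where

  ConjBy-transitive : ∀ {ζ η η′ : SnΩ n ν} → ConjBy ζ σ η η′ → TransitiveOnEach σ c η → TransitiveOnEach σ c η′
  ConjBy-transitive {ζ} {η} {η′} conj η-trans i k k′ ω ω′ ci ci′ =
    let m , e = η-trans i (ζ ω ⟨$⟩ˡ k) (ζ ω′ ⟨$⟩ˡ k′) ω ω′ ci ci′ in
    m , (begin
      iter (actζσ η′ σ) m (k , ω)                         ≡⟨ cong (λ x → iter (actζσ η′ σ) m (x , ω)) (inverseʳ (ζ ω)) ⟨
      iter (actζσ η′ σ) m (actζ ζ (ζ ω ⟨$⟩ˡ k , ω))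
        ≡⟨ iter-semiconj {f = actζσ η σ} {actζσ η′ σ} (actζ ζ) conj m (ζ ω ⟨$⟩ˡ k , ω) ⟨
      actζ ζ (iter (actζσ η σ) m (ζ ω ⟨$⟩ˡ k , ω))        ≡⟨ cong (actζ ζ) e ⟩
      (ζ ω′ ⟨$⟩ʳ (ζ ω′ ⟨$⟩ˡ k′) , ω′)                      ≡⟨ cong (_, ω′) (inverseʳ (ζ ω′)) ⟩
      (k′ , ω′)                                           ∎)
    where open ≡-Reasoning

conjugate-transitive : ∀ {n ν r} (σ : Permutation′ ν) (c : Fin ν → Fin r) (ζ η : SnΩ n ν) →
                       TransitiveOnEach σ c η → TransitiveOnEach σ c (conjugate σ ζ η)
conjugate-transitive σ c ζ η = ConjBy-transitive {σ = σ} {c} {ζ} {η} {conjugate σ ζ η} (ConjBy-conjugate σ ζ η)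

module WreathProduct (n′ ν : ℕ) (σ : Permutation′ ν) (r : ℕ) (c : Fin ν → Fin r)
                     (orbits : IsOrbitDecomposition σ c) where

  n : ℕ
  n = suc n′

  σ^ : ℕ → Fin ν → Fin ν
  σ^ = iter (σ ⟨$⟩ʳ_)

  c-σ^ : ∀ j ω → c (σ^ j ω) ≡ c ω
  c-σ^ j ω = sym (proj₂ (proj₂ orbits ω (σ^ j ω)) (j , refl))

  base : Fin r → Fin ν
  base i = proj₁ (proj₁ orbits i)

  c-base : ∀ i → c (base i) ≡ i
  c-base i = proj₂ (proj₁ orbits i)

  rep : Fin ν → Fin ν
  rep ω = base (c ω)

  IsBase : Fin ν → Set
  IsBase ω = ω ≡ rep ω

  isBase? : ∀ ω → Dec (IsBase ω)
  isBase? ω = ω ≟ᶠ rep ω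

  rep-isBase : ∀ ω → IsBase (rep ω)
  rep-isBase ω = sym (cong base (c-base (c ω)))

  module Orbit (b : Fin ν) = Period (σ ⟨$⟩ʳ_) (⟨$⟩ʳ-injective σ) b

  len : Fin ν → ℕ
  len = Orbit.period

  σ^-len : ∀ b → σ^ (len b) b ≡ b
  σ^-len = Orbit.period-return

  -- len b is a successor, so len b reduces to suc (last b).
  last : Fin ν → ℕ
  last b = pred (len b)

  from-rep : ∀ ω → SameOrbit σ (rep ω) ω
  from-rep ω = proj₁ (proj₂ orbits (rep ω) ω) (c-base (c ω))

  idx : Fin ν → ℕ
  idx ω = proj₁ (from-rep ω) % len (rep ω)

  idx< : ∀ ω → idx ω < len (rep ω)
  idx< ω = m%n<n (proj₁ (from-rep ω)) (len (rep ω))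

  σ^-idx : ∀ ω → σ^ (idx ω) (rep ω) ≡ ω
  σ^-idx ω = trans (sym (Orbit.iter-% (rep ω) (proj₁ (from-rep ω)))) (proj₂ (from-rep ω))

  σ^-not-base : ∀ {b} → IsBase b → ∀ j → 0 < j → j < len b → ¬ IsBase (σ^ j b)
  σ^-not-base {b} b-base j 0<j j<len e =
    Orbit.period-minimal b j 0<j j<len (trans e (trans (cong base (c-σ^ j b)) (sym b-base)))

  preserves-orbits : (η : SnΩ n ν) (i : Fin r) (k : Fin n) (ω : Fin ν) → c ω ≡ i →
                     c (proj₂ (actζσ η σ (k , ω))) ≡ i
  preserves-orbits η i k ω ci = trans (c-σ^ 1 ω) ci

  walk : SnΩ n ν → Fin ν → ℕ → Permutation′ n
  walk η ω zero    = idₚ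
  walk η ω (suc m) = walk η ω m ∘ₚ η (σ^ (suc m) ω)

  iter-actζσ : ∀ η ω m k → iter (actζσ η σ) m (k , ω) ≡ (walk η ω m ⟨$⟩ʳ k , σ^ m ω)
  iter-actζσ η ω zero    k = refl
  iter-actζσ η ω (suc m) k = cong (actζσ η σ) (iter-actζσ η ω m k)

  holonomy : SnΩ n ν → Fin ν → Permutation′ n
  holonomy η b = walk η b (len b)

  iter-actζσ-laps : ∀ η b t k → iter (actζσ η σ) (t * len b) (k , b) ≡ (iter (holonomy η b ⟨$⟩ʳ_) t k , b)
  iter-actζσ-laps η b zero    k = refl
  iter-actζσ-laps η b (suc t) k = begin
    iter (actζσ η σ) (len b + t * len b) (k , b)               ≡⟨ iter-+ (actζσ η σ) (len b) (t * len b) (k , b) ⟩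
    iter (actζσ η σ) (len b) (iter (actζσ η σ) (t * len b) (k , b))
                                                              ≡⟨ cong (iter (actζσ η σ) (len b)) (iter-actζσ-laps η b t k) ⟩
    iter (actζσ η σ) (len b) (iter (holonomy η b ⟨$⟩ʳ_) t k , b) ≡⟨ iter-actζσ η b (len b) _ ⟩
    (iter (holonomy η b ⟨$⟩ʳ_) (suc t) k , σ^ (len b) b)       ≡⟨ cong (iter (holonomy η b ⟨$⟩ʳ_) (suc t) k ,_) (σ^-len b) ⟩
    (iter (holonomy η b ⟨$⟩ʳ_) (suc t) k , b)                  ∎
    where open ≡-Reasoning

  -- A return to the fibre over b takes a multiple of len b steps.
  transitive⇒holonomy-isCycle : ∀ η → TransitiveOnEach σ c η → ∀ b → IsCycle (holonomy η b)
  transitive⇒holonomy-isCycle η η-trans b k k′ = m / len b , cong proj₁ (begin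
    (iter (holonomy η b ⟨$⟩ʳ_) (m / len b) k , b) ≡⟨ iter-actζσ-laps η b (m / len b) k ⟨
    iter (actζσ η σ) (m / len b * len b) (k , b)  ≡⟨ cong (λ l → iter (actζσ η σ) l (k , b)) m≡laps ⟨
    iter (actζσ η σ) m (k , b)                    ≡⟨ e ⟩
    (k′ , b)                                      ∎)
    where
    open ≡-Reasoning
    m = proj₁ (η-trans (c b) k k′ b b refl refl)
    e = proj₂ (η-trans (c b) k k′ b b refl refl)
    m%len≡0 : m % len b ≡ 0
    m%len≡0 = Orbit.iter-≡⇒%-≡ b m 0 (cong proj₂ (trans (sym (iter-actζσ η b m k)) e))
    m≡laps : m ≡ m / len b * len b
    m≡laps = trans (m≡m%n+[m/n]*n m (len b)) (cong (_+ m / len b * len b) m%len≡0)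

  module _ (η : SnΩ n ν) (b : Fin ν) where

    reach-base : ∀ j → j ≤ len b → ∀ k → ∃ λ k₁ → iter (actζσ η σ) (len b ∸ j) (k , σ^ j b) ≡ (k₁ , b)
    reach-base j j≤len k = walk η (σ^ j b) (len b ∸ j) ⟨$⟩ʳ k ,
      trans (iter-actζσ η (σ^ j b) (len b ∸ j) k)
            (cong (walk η (σ^ j b) (len b ∸ j) ⟨$⟩ʳ k ,_) (trans (sym (iter-+ (σ ⟨$⟩ʳ_) (len b ∸ j) j b))
                                (trans (cong (λ l → σ^ l b) (m∸n+n≡m j≤len)) (σ^-len b))))

    leave-base : IsCycle (holonomy η b) → ∀ k k′ j′ → ∃ λ m → iter (actζσ η σ) m (k , b) ≡ (k′ , σ^ j′ b)
    leave-base cycle k k′ j′ = j′ + t * len b , (begin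
      iter (actζσ η σ) (j′ + t * len b) (k , b)              ≡⟨ iter-+ (actζσ η σ) j′ (t * len b) (k , b) ⟩
      iter (actζσ η σ) j′ (iter (actζσ η σ) (t * len b) (k , b)) ≡⟨ cong (iter (actζσ η σ) j′) (iter-actζσ-laps η b t k) ⟩
      iter (actζσ η σ) j′ (iter (holonomy η b ⟨$⟩ʳ_) t k , b)  ≡⟨ cong (λ x → iter (actζσ η σ) j′ (x , b)) laps ⟩
      iter (actζσ η σ) j′ (walk η b j′ ⟨$⟩ˡ k′ , b)           ≡⟨ iter-actζσ η b j′ _ ⟩
      (walk η b j′ ⟨$⟩ʳ (walk η b j′ ⟨$⟩ˡ k′) , σ^ j′ b)      ≡⟨ cong (_, σ^ j′ b) (inverseʳ (walk η b j′)) ⟩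
      (k′ , σ^ j′ b)                                         ∎)
      where
      open ≡-Reasoning
      t = proj₁ (cycle k (walk η b j′ ⟨$⟩ˡ k′))
      laps = proj₂ (cycle k (walk η b j′ ⟨$⟩ˡ k′))

  holonomy-isCycle⇒transitive : ∀ η → (∀ b → IsBase b → IsCycle (holonomy η b)) → TransitiveOnEach σ c η
  holonomy-isCycle⇒transitive η cycle i k k′ ω ω′ ci ci′ =
    m₂ + (len b ∸ idx ω) , (begin
      iter (actζσ η σ) (m₂ + (len b ∸ idx ω)) (k , ω)             ≡⟨ iter-+ (actζσ η σ) m₂ (len b ∸ idx ω) (k , ω) ⟩
      iter (actζσ η σ) m₂ (iter (actζσ η σ) (len b ∸ idx ω) (k , ω)) ≡⟨ cong (iter (actζσ η σ) m₂) to-base ⟩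
      iter (actζσ η σ) m₂ (k₁ , b)                                  ≡⟨ from-base ⟩
      (k′ , σ^ j′ b)                                                ≡⟨ cong (k′ ,_) σ^j′b≡ω′ ⟩
      (k′ , ω′)                                                     ∎)
    where
    open ≡-Reasoning
    b = rep ω
    same-orbit = proj₁ (proj₂ orbits b ω′) (trans (c-base (c ω)) (trans ci (sym ci′)))
    j′ = proj₁ same-orbit
    σ^j′b≡ω′ = proj₂ same-orbit
    reached = reach-base η b (idx ω) (<⇒≤ (idx< ω)) k
    k₁ = proj₁ reached
    to-base : iter (actζσ η σ) (len b ∸ idx ω) (k , ω) ≡ (k₁ , b)
    to-base = subst (λ x → iter (actζσ η σ) (len b ∸ idx ω) (k , x) ≡ (k₁ , b)) (σ^-idx ω) (proj₂ reached)
    m₂ = proj₁ (leave-base η b (cycle b (rep-isBase ω)) k₁ k′ j′)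
    from-base = proj₂ (leave-base η b (cycle b (rep-isBase ω)) k₁ k′ j′)

  walk-cong : ∀ η θ ω m → (∀ j → 0 < j → j ≤ m → η (σ^ j ω) ≈ₚ θ (σ^ j ω)) → walk η ω m ≈ₚ walk θ ω m
  walk-cong η θ ω zero    agree k = refl
  walk-cong η θ ω (suc m) agree k =
    trans (cong (η (σ^ (suc m) ω) ⟨$⟩ʳ_) (walk-cong η θ ω m (λ j 0<j j≤m → agree j 0<j (m≤n⇒m≤1+n j≤m)) k))
          (agree (suc m) (s≤s z≤n) ≤-refl _)

  -- Before it returns, the walk from a base point meets no base point.
  walk-off-base : ∀ {η θ : SnΩ n ν} → (∀ ω → ¬ IsBase ω → η ω ≈ₚ θ ω) → ∀ {b} → IsBase b →
                  walk η b (last b) ≈ₚ walk θ b (last b)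
  walk-off-base {η} {θ} agree {b} b-base =
    walk-cong η θ b (last b) (λ j 0<j j≤last → agree (σ^ j b) (σ^-not-base b-base j 0<j (s≤s j≤last)))

  gauge : SnΩ n ν → SnΩ n ν
  gauge η ω = if does (isBase? ω) then holonomy η ω else η ω

  ungauge : SnΩ n ν → SnΩ n ν
  ungauge θ ω = if does (isBase? ω) then flip (walk θ ω (last ω)) ∘ₚ θ ω else θ ω

  module _ {A : Set} (ω : Fin ν) {x y : A} where

    if-base : IsBase ω → (if does (isBase? ω) then x else y) ≡ x
    if-base b = cong (λ t → if t then x else y) (dec-true (isBase? ω) b)

    if-not-base : ¬ IsBase ω → (if does (isBase? ω) then x else y) ≡ y
    if-not-base ¬b = cong (λ t → if t then x else y) (dec-false (isBase? ω) ¬b)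

  base-cases : ∀ {P : Set} ω → (IsBase ω → P) → (¬ IsBase ω → P) → P
  base-cases ω on-base off-base with isBase? ω
  ... | yes b = on-base b
  ... | no ¬b = off-base ¬b

  gauge-base : ∀ η ω → IsBase ω → gauge η ω ≈ₚ holonomy η ω
  gauge-base η ω b k = cong (_⟨$⟩ʳ k) (if-base ω b)

  ungauge-base : ∀ θ ω → IsBase ω → ungauge θ ω ≈ₚ flip (walk θ ω (last ω)) ∘ₚ θ ω
  ungauge-base θ ω b k = cong (_⟨$⟩ʳ k) (if-base ω b)

  gauge-off-base : ∀ η ω → ¬ IsBase ω → gauge η ω ≈ₚ η ω
  gauge-off-base η ω ¬b k = cong (_⟨$⟩ʳ k) (if-not-base ω ¬b)

  ungauge-off-base : ∀ θ ω → ¬ IsBase ω → ungauge θ ω ≈ₚ θ ω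
  ungauge-off-base θ ω ¬b k = cong (_⟨$⟩ʳ k) (if-not-base ω ¬b)

  gauge-cong : ∀ η η′ → (∀ ω → η ω ≈ₚ η′ ω) → ∀ ω → gauge η ω ≈ₚ gauge η′ ω
  gauge-cong η η′ e ω k = base-cases ω
    (λ b → trans (gauge-base η ω b k)
                 (trans (walk-cong η η′ ω (len ω) (λ j _ _ → e (σ^ j ω)) k) (sym (gauge-base η′ ω b k))))
    (λ ¬b → trans (gauge-off-base η ω ¬b k) (trans (e ω k) (sym (gauge-off-base η′ ω ¬b k))))

  ungauge-cong : ∀ θ θ′ → (∀ ω → θ ω ≈ₚ θ′ ω) → ∀ ω → ungauge θ ω ≈ₚ ungauge θ′ ω
  ungauge-cong θ θ′ e ω k = base-cases ω
    (λ b → trans (ungauge-base θ ω b k)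
                 (trans (∘ₚ-cong (flip (walk θ ω (last ω))) (flip (walk θ′ ω (last ω))) (θ ω) (θ′ ω)
                                 (flip-cong (walk θ ω (last ω)) (walk θ′ ω (last ω))
                                            (walk-cong θ θ′ ω (last ω) (λ j _ _ → e (σ^ j ω))))
                                 (e ω) k)
                        (sym (ungauge-base θ′ ω b k))))
    (λ ¬b → trans (ungauge-off-base θ ω ¬b k) (trans (e ω k) (sym (ungauge-off-base θ′ ω ¬b k))))

  ungauge∘gauge : ∀ η ω → ungauge (gauge η) ω ≈ₚ η ω
  ungauge∘gauge η b k = base-cases b on-base
    (λ ¬b → trans (ungauge-off-base (gauge η) b ¬b k) (gauge-off-base η b ¬b k))
    where
    open ≡-Reasoning
    on-base : IsBase b → ungauge (gauge η) b ⟨$⟩ʳ k ≡ η b ⟨$⟩ʳ k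
    on-base b-base = begin
      ungauge (gauge η) b ⟨$⟩ʳ k                                         ≡⟨ ungauge-base (gauge η) b b-base k ⟩
      gauge η b ⟨$⟩ʳ (walk (gauge η) b (last b) ⟨$⟩ˡ k)                  ≡⟨ gauge-base η b b-base _ ⟩
      η (σ^ (len b) b) ⟨$⟩ʳ (walk η b (last b) ⟨$⟩ʳ (walk (gauge η) b (last b) ⟨$⟩ˡ k))
                                                                         ≡⟨ cong (λ x → η (σ^ (len b) b) ⟨$⟩ʳ (walk η b (last b) ⟨$⟩ʳ x))
                                                                              (flip-cong (walk (gauge η) b (last b)) (walk η b (last b))
                                                                                         (walk-off-base (gauge-off-base η) b-base) k) ⟩
      η (σ^ (len b) b) ⟨$⟩ʳ (walk η b (last b) ⟨$⟩ʳ (walk η b (last b) ⟨$⟩ˡ k))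
                                                                         ≡⟨ cong (η (σ^ (len b) b) ⟨$⟩ʳ_) (inverseʳ (walk η b (last b))) ⟩
      η (σ^ (len b) b) ⟨$⟩ʳ k                                            ≡⟨ cong (λ ω → η ω ⟨$⟩ʳ k) (σ^-len b) ⟩
      η b ⟨$⟩ʳ k                                                         ∎

  gauge∘ungauge : ∀ θ ω → gauge (ungauge θ) ω ≈ₚ θ ω
  gauge∘ungauge θ b k = base-cases b on-base
    (λ ¬b → trans (gauge-off-base (ungauge θ) b ¬b k) (ungauge-off-base θ b ¬b k))
    where
    open ≡-Reasoning
    on-base : IsBase b → gauge (ungauge θ) b ⟨$⟩ʳ k ≡ θ b ⟨$⟩ʳ k
    on-base b-base = begin
      gauge (ungauge θ) b ⟨$⟩ʳ k                                         ≡⟨ gauge-base (ungauge θ) b b-base k ⟩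
      ungauge θ (σ^ (len b) b) ⟨$⟩ʳ (walk (ungauge θ) b (last b) ⟨$⟩ʳ k)
                                                                         ≡⟨ cong (λ ω → ungauge θ ω ⟨$⟩ʳ (walk (ungauge θ) b (last b) ⟨$⟩ʳ k)) (σ^-len b) ⟩
      ungauge θ b ⟨$⟩ʳ (walk (ungauge θ) b (last b) ⟨$⟩ʳ k)              ≡⟨ ungauge-base θ b b-base _ ⟩
      θ b ⟨$⟩ʳ (walk θ b (last b) ⟨$⟩ˡ (walk (ungauge θ) b (last b) ⟨$⟩ʳ k))
                                                                         ≡⟨ cong (λ x → θ b ⟨$⟩ʳ (walk θ b (last b) ⟨$⟩ˡ x))
                                                                              (walk-off-base (ungauge-off-base θ) b-base k) ⟩
      θ b ⟨$⟩ʳ (walk θ b (last b) ⟨$⟩ˡ (walk θ b (last b) ⟨$⟩ʳ k))        ≡⟨ cong (θ b ⟨$⟩ʳ_) (inverseˡ (walk θ b (last b))) ⟩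
      θ b ⟨$⟩ʳ k                                                         ∎

  gauge-isCycle : ∀ η → TransitiveOnEach σ c η → ∀ ω → IsBase ω → IsCycle (gauge η ω)
  gauge-isCycle η η-trans ω b =
    IsCycle-resp (holonomy η ω) (gauge η ω) (λ k → sym (gauge-base η ω b k)) (transitive⇒holonomy-isCycle η η-trans ω)

  ungauge-transitive : ∀ θ → (∀ ω → IsBase ω → IsCycle (θ ω)) → TransitiveOnEach σ c (ungauge θ)
  ungauge-transitive θ cycle = holonomy-isCycle⇒transitive (ungauge θ) λ b b-base →
    IsCycle-resp (θ b) (holonomy (ungauge θ) b)
      (λ k → trans (sym (gauge∘ungauge θ b k)) (gauge-base (ungauge θ) b b-base k)) (cycle b b-base)

  T↔Π : Inverse (T-setoid {n} σ c) (Π-setoid ν (λ ω → CycleIf n (IsBase ω)))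
  T↔Π = mkInverse
    (λ (η , η-trans) ω → gauge η ω , gauge-isCycle η η-trans ω)
    (λ θ → ungauge (proj₁ ∘ θ) , ungauge-transitive (proj₁ ∘ θ) (proj₂ ∘ θ))
    (λ {(η , _)} {(η′ , _)} e → gauge-cong η η′ (actζσ-≡⇒≈ σ η η′ e))
    (λ {θ} {θ′} e →
      ≈⇒actζσ-≡ σ (ungauge (proj₁ ∘ θ)) (ungauge (proj₁ ∘ θ′)) (ungauge-cong (proj₁ ∘ θ) (proj₁ ∘ θ′) e))
    (λ θ → gauge∘ungauge (proj₁ ∘ θ))
    (λ (η , _) → ≈⇒actζσ-≡ σ (ungauge (gauge η)) η (ungauge∘gauge η))

  Bases↔Fin : Inverse (Subset IsBase) (setoid (Fin r))
  Bases↔Fin = mkInverse (c ∘ proj₁) (λ i → base i , sym (cong base (c-base i)))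
    (cong c) (cong base) c-base (λ (_ , b) → sym b)

  #bases≡r : count isBase? ≡ r
  #bases≡r = ↔⇒≡ (Symmetry.inverse (Subset↔Fin-count isBase?) ⨾ Bases↔Fin)

  |T| : ℕ
  |T| = ∏ ν (λ ω → if does (isBase? ω) then n′ ! else n !)

  T↔Fin : Inverse (T-setoid {n} σ c) (setoid (Fin |T|))
  T↔Fin = T↔Π ⨾ Π↔Fin∏ ν _ _ (λ ω → CycleIf↔Fin n′ (isBase? ω))

  [n!^ν]/n^r≡|T| : _/_ ((n !) ^ ν) (n ^ r) {{m^n≢0 n r}} ≡ |T|
  [n!^ν]/n^r≡|T| = begin
    (n !) ^ ν / n ^ r              ≡⟨ /-congˡ (∏-CycleIf-size n′ ν isBase?) ⟨
    |T| * n ^ count isBase? / n ^ r ≡⟨ cong (λ e → |T| * n ^ e / n ^ r) #bases≡r ⟩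
    |T| * n ^ r / n ^ r            ≡⟨ m*n/n≡m |T| (n ^ r) ⟩
    |T|                            ∎
    where
    open ≡-Reasoning
    instance
      n^r≢0 : NonZero (n ^ r)
      n^r≢0 = m^n≢0 n r

  -- Over each base point b, match b conjugates the two holonomies; it is then
  -- transported along the orbit of b by the two walks.
  module Conjugator (η η′ : SnΩ n ν) (η-trans : TransitiveOnEach σ c η)
                    (η′-trans : TransitiveOnEach σ c η′) where

    private
      unroll : ∀ η → TransitiveOnEach σ c η → Fin ν → Permutation′ n
      unroll η η-trans b = Unrolling.unroll (holonomy η b) (transitive⇒holonomy-isCycle η η-trans b)

    match : Fin ν → Permutation′ n
    match b = flip (unroll η η-trans b) ∘ₚ unroll η′ η′-trans b

    match-holonomy : ∀ b x → match b ⟨$⟩ʳ (holonomy η b ⟨$⟩ʳ x) ≡ holonomy η′ b ⟨$⟩ʳ (match b ⟨$⟩ʳ x)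
    match-holonomy b x =
      trans (cong (unroll η′ η′-trans b ⟨$⟩ʳ_) (U.unroll⁻¹-C x))
            (U′.unroll-rotate (unroll η η-trans b ⟨$⟩ˡ x))
      where
      module U  = Unrolling (holonomy η b) (transitive⇒holonomy-isCycle η η-trans b)
      module U′ = Unrolling (holonomy η′ b) (transitive⇒holonomy-isCycle η′ η′-trans b)

    along : Fin ν → ℕ → Permutation′ n
    along b j = flip (walk η b j) ∘ₚ match b ∘ₚ walk η′ b j

    ζ : SnΩ n ν
    ζ ω = along (rep ω) (idx ω)

    ζ-along : ∀ b j → IsBase b → j < len b → ζ (σ^ j b) ≈ₚ along b j
    ζ-along b j b-base j<len = position (σ^ j b) (trans (cong base (c-σ^ j b)) (sym b-base)) refl
      where
      position : ∀ ω → rep ω ≡ b → σ^ j b ≡ ω → ζ ω ≈ₚ along b j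
      position ω refl e x = cong (λ i → along (rep ω) i ⟨$⟩ʳ x)
        (Orbit.iter-injective-< (rep ω) (idx ω) j (idx< ω) j<len (trans (σ^-idx ω) (sym e)))

    walk⁻¹-suc : ∀ b j k → walk η b (suc j) ⟨$⟩ˡ (η (σ^ (suc j) b) ⟨$⟩ʳ k) ≡ walk η b j ⟨$⟩ˡ k
    walk⁻¹-suc b j k = ⟨$⟩ʳ-injective (walk η b (suc j))
      (trans (inverseʳ (walk η b (suc j))) (cong (η (σ^ (suc j) b) ⟨$⟩ʳ_) (sym (inverseʳ (walk η b j)))))

    ConjBy-step : Fin ν → ℕ → Set
    ConjBy-step b j = ∀ k → ζ (σ^ (suc j) b) ⟨$⟩ʳ (η (σ^ (suc j) b) ⟨$⟩ʳ k)
                          ≡ η′ (σ^ (suc j) b) ⟨$⟩ʳ (ζ (σ^ j b) ⟨$⟩ʳ k)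

    step-inside : ∀ b j → IsBase b → suc j < len b → ConjBy-step b j
    step-inside b j b-base j+1<len k = begin
      ζ (σ^ (suc j) b) ⟨$⟩ʳ (η (σ^ (suc j) b) ⟨$⟩ʳ k)
        ≡⟨ ζ-along b (suc j) b-base j+1<len _ ⟩
      walk η′ b (suc j) ⟨$⟩ʳ (match b ⟨$⟩ʳ (walk η b (suc j) ⟨$⟩ˡ (η (σ^ (suc j) b) ⟨$⟩ʳ k)))
        ≡⟨ cong (λ x → walk η′ b (suc j) ⟨$⟩ʳ (match b ⟨$⟩ʳ x)) (walk⁻¹-suc b j k) ⟩
      η′ (σ^ (suc j) b) ⟨$⟩ʳ (along b j ⟨$⟩ʳ k)
        ≡⟨ cong (η′ (σ^ (suc j) b) ⟨$⟩ʳ_) (ζ-along b j b-base (<-trans (n<1+n j) j+1<len) k) ⟨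
      η′ (σ^ (suc j) b) ⟨$⟩ʳ (ζ (σ^ j b) ⟨$⟩ʳ k) ∎
      where open ≡-Reasoning

    -- The step that closes the orbit is where match b intertwines the holonomies.
    step-last : ∀ b → IsBase b → ConjBy-step b (last b)
    step-last b b-base k = begin
      ζ (σ^ (len b) b) ⟨$⟩ʳ (η (σ^ (len b) b) ⟨$⟩ʳ k)
        ≡⟨ cong (λ ω → ζ ω ⟨$⟩ʳ (η (σ^ (len b) b) ⟨$⟩ʳ k)) (σ^-len b) ⟩
      ζ b ⟨$⟩ʳ (η (σ^ (len b) b) ⟨$⟩ʳ k)
        ≡⟨ ζ-along b 0 b-base (s≤s z≤n) _ ⟩
      match b ⟨$⟩ʳ (η (σ^ (len b) b) ⟨$⟩ʳ k)
        ≡⟨ cong (λ x → match b ⟨$⟩ʳ (η (σ^ (len b) b) ⟨$⟩ʳ x)) (inverseʳ (walk η b (last b))) ⟨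
      match b ⟨$⟩ʳ (holonomy η b ⟨$⟩ʳ (walk η b (last b) ⟨$⟩ˡ k))
        ≡⟨ match-holonomy b (walk η b (last b) ⟨$⟩ˡ k) ⟩
      η′ (σ^ (len b) b) ⟨$⟩ʳ (along b (last b) ⟨$⟩ʳ k)
        ≡⟨ cong (η′ (σ^ (len b) b) ⟨$⟩ʳ_) (ζ-along b (last b) b-base ≤-refl k) ⟨
      η′ (σ^ (len b) b) ⟨$⟩ʳ (ζ (σ^ (last b) b) ⟨$⟩ʳ k) ∎
      where open ≡-Reasoning

    step : ∀ b j → IsBase b → j < len b → ConjBy-step b j
    step b j b-base j<len with m≤n⇒m<n∨m≡n j<len
    ... | inj₁ j+1<len = step-inside b j b-base j+1<len
    ... | inj₂ j+1≡len = subst (ConjBy-step b) (sym (suc-injective j+1≡len)) (step-last b b-base)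

    ζ-ConjBy : ConjBy ζ σ η η′
    ζ-ConjBy (k , ω) = cong (_, σ ⟨$⟩ʳ ω)
      (subst (λ x → ζ (σ ⟨$⟩ʳ x) ⟨$⟩ʳ (η (σ ⟨$⟩ʳ x) ⟨$⟩ʳ k) ≡ η′ (σ ⟨$⟩ʳ x) ⟨$⟩ʳ (ζ x ⟨$⟩ʳ k)) (σ^-idx ω)
        (step (rep ω) (idx ω) (rep-isBase ω) (idx< ω) k))

lemma5p1 : (n : ℕ) .{{_ : NonZero n}} (ν : ℕ) (σ : Permutation′ ν)
    (r : ℕ) (c : Fin ν → Fin r) → IsOrbitDecomposition σ c →
    -- (a) ησ maps each [n] × Ω_i to itself
    ((η : SnΩ n ν) (i : Fin r) (k : Fin n) (ω : Fin ν) → c ω ≡ i →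
      c (proj₂ (actζσ η σ (k , ω))) ≡ i)
    ×
    -- (b1) S_n^Ω acts on T by conjugation (T is closed under conjugation)
    ((ζ η : SnΩ n ν) → TransitiveOnEach σ c η →
      ∃ λ η' → TransitiveOnEach σ c η' × ConjBy ζ σ η η')
    ×
    -- (b2) this action is transitive
    ((η η' : SnΩ n ν) → TransitiveOnEach σ c η → TransitiveOnEach σ c η' →
      ∃ λ ζ → ConjBy ζ σ η η')
    ×
    -- (b3) |T| = (n!)^ν / n^r
    Bijection (T-setoid {n} {ν} {r} σ c) (setoid (Fin (_/_ ((n !) ^ ν) (n ^ r) {{m^n≢0 n r}})))
lemma5p1 zero {{()}}
lemma5p1 (suc n′) ν σ r c orbits =
    preserves-orbits
  , (λ ζ η η-trans → conjugate σ ζ η , conjugate-transitive σ c ζ η η-trans , ConjBy-conjugate σ ζ η)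
  , (λ η η′ η-trans η′-trans → Conjugator.ζ η η′ η-trans η′-trans , Conjugator.ζ-ConjBy η η′ η-trans η′-trans)
  , subst (λ N → Bijection (T-setoid σ c) (setoid (Fin N))) (sym [n!^ν]/n^r≡|T|) (Inverse⇒Bijection T↔Fin)
  where open WreathProduct n′ ν σ r c orbits
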